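{- Let $\mathbf U=\langle\langle U,\approx\rangle,\preceq\rangle$ be a completely lattice $\mathbf L$-ordered set and $\sim$ a complete $\mathbf L$-tolerance on $\mathbf U$. For each $u\in U$, the class $[u]_\sim$ is equal to the $\mathbf L$-interval $[\![u_\sim,u^\sim]\!]$.
   Context: $\mathbf L=\langle L,\wedge,\vee,\otimes,\to,0,1\rangle$ is a complete residuated lattice ($\langle L,\wedge,\vee,0,1\rangle$ complete lattice, $\langle L,\otimes,1\rangle$ commutative monoid, $a\otimes b\le c$ iff $a\le b\to c$). An $\mathbf L$-set in $X$ is a map $X\to L$; $L^X$ the set of them; $S(A,B)=\bigwedge_x(A(x)\to B(x))$. An $\mathbf L$-equality is a binary $\mathbf L$-relation that is reflexive, symmetric, transitive ($R(x,y)\otimes R(y,z)\le R(x,z)$) and with $R(x,y)=1\Rightarrow x=y$. An $\mathbf L$-ordered set is $\langle\langle U,\approx\rangle,\preceq\rangle$, $\approx$ an $\mathbf L$-equality, $\preceq$ reflexive, transitive, compatible with $\approx$ ($(u\preceq v)\otimes(u\approx u')\otimes(v\approx v')\le(u'\preceq v')$), and $(u\preceq v)\wedge(v\preceq u)\le u\approx v$; $u\le v$ means $(u\preceq v)=1$. For $V\in L^U$: $\mathcal L V(v)=\bigwedge_u(V(u)\to(v\preceq u))$, $\mathcal U V(v)=\bigwedge_u(V(u)\to(u\preceq v))$; $\inf V$ is the unique $u$ with $\mathcal L V(u)=1=\mathcal U(\mathcal L V)(u)$, $\sup V$ the unique $u$ with $\mathcal U V(u)=1=\mathcal L(\mathcal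 U V)(u)$; completely lattice means these exist for all $V$. For $v\le u$, $[\![v,u]\!](w)=(v\preceq w)\wedge(w\preceq u)$. Power relation: for $R$ on $X$, $A,B\in L^X$, $(R\circ B)(x)=\bigvee_y R(x,y)\otimes B(y)$, $(A\circ R)(y)=\bigvee_x A(x)\otimes R(x,y)$, $R^+(A,B)=S(A,R\circ B)\wedge S(B,A\circ R)$. A binary $\mathbf L$-relation $R$ on $\mathbf U$ is complete if it is compatible with $\approx$ ($R(u,v)\otimes(u\approx u')\otimes(v\approx v')\le R(u',v')$) and $R^+(V_1,V_2)\le R(\inf V_1,\inf V_2)$, $R^+(V_1,V_2)\le R(\sup V_1,\sup V_2)$ for all $V_1,V_2\in L^U$. An $\mathbf L$-tolerance is a reflexive symmetric binary $\mathbf L$-relation. For $u\in U$, the class $[u]_\sim\in L^U$ is $[u]_\sim(v)=u\sim v$, and $u_\sim=\inf[u]_\sim$, $u^\sim=\sup[u]_\sim$. -}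

module Defs where

open import Level using (Level; 0ℓ)
open import Data.Product using (Σ; _×_; _,_)
open import Relation.Binary.PropositionalEquality using (_≡_)
open import Relation.Binary.Structures using (IsPartialOrder)

record CompleteResiduatedLattice : Set₁ where
  infixr 6 _∧_
  infixr 5 _∨_
  infixl 7 _⊗_
  infixr 4 _⇒_
  infix 3 _≤_
  field
    Carrier : Set
    _≤_     : Carrier → Carrier → Set
    isPartialOrder : IsPartialOrder _≡_ _≤_
    ⋀ : {I : Set} → (I → Carrier) → Carrier
    ⋁ : {I : Set} → (I → Carrier) → Carrier
    ⋀-lower    : {I : Set} (f : I → Carrier) (i : I) → ⋀ f ≤ f i
    ⋀-greatest : {I : Set} (f : I → Carrier) (a : Carrier) → ((i : I) → a ≤ f i) → a ≤ ⋀ f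
    ⋁-upper    : {I : Set} (f : I → Carrier) (i : I) → f i ≤ ⋁ f
    ⋁-least    : {I : Set} (f : I → Carrier) (a : Carrier) → ((i : I) → f i ≤ a) → ⋁ f ≤ a
    _∧_ _∨_ : Carrier → Carrier → Carrier
    ∧-lowerˡ : ∀ a b → a ∧ b ≤ a
    ∧-lowerʳ : ∀ a b → a ∧ b ≤ b
    ∧-greatest : ∀ a b c → c ≤ a → c ≤ b → c ≤ a ∧ b
    ∨-upperˡ : ∀ a b → a ≤ a ∨ b
    ∨-upperʳ : ∀ a b → b ≤ a ∨ b
    ∨-least : ∀ a b c → a ≤ c → b ≤ c → a ∨ b ≤ c
    𝟎 𝟏 : Carrier
    𝟎-least : ∀ a → 𝟎 ≤ a
    𝟏-greatest : ∀ a → a ≤ 𝟏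
    _⊗_ : Carrier → Carrier → Carrier
    ⊗-assoc : ∀ a b c → (a ⊗ b) ⊗ c ≡ a ⊗ (b ⊗ c)
    ⊗-comm  : ∀ a b → a ⊗ b ≡ b ⊗ a
    ⊗-identityˡ : ∀ a → 𝟏 ⊗ a ≡ a
    _⇒_ : Carrier → Carrier → Carrier
    adjoint₁ : ∀ {a b c} → a ⊗ b ≤ c → a ≤ b ⇒ c
    adjoint₂ : ∀ {a b c} → a ≤ b ⇒ c → a ⊗ b ≤ c

module _ (𝐋 : CompleteResiduatedLattice) where
  open CompleteResiduatedLattice 𝐋

  LSet : Set → Set
  LSet X = X → Carrier

  Rel : Set → Set
  Rel X = X → X → Carrier

  S : {X : Set} → LSet X → LSet X → Carrier
  S A B = ⋀ (λ x → A x ⇒ B x)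

  record IsLEquality {X : Set} (E : Rel X) : Set where
    field
      refl  : ∀ x → E x x ≡ 𝟏
      sym   : ∀ x y → E x y ≡ E y x
      trans : ∀ x y z → E x y ⊗ E y z ≤ E x z
      sep   : ∀ x y → E x y ≡ 𝟏 → x ≡ y

  record LOrderedSet : Set₁ where
    field
      U   : Set
      _≈_ : Rel U
      _≼_ : Rel U
      ≈-isLEquality : IsLEquality _≈_
      ≼-refl   : ∀ u → (u ≼ u) ≡ 𝟏
      ≼-trans  : ∀ u v w → (u ≼ v) ⊗ (v ≼ w) ≤ (u ≼ w)
      ≼-compat : ∀ u v u' v' → (u ≼ v) ⊗ (u ≈ u') ⊗ (v ≈ v') ≤ (u' ≼ v')
      ≼-antisym : ∀ u v → (u ≼ v) ∧ (v ≼ u) ≤ (u ≈ v)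

  module _ (𝐔 : LOrderedSet) where
    open LOrderedSet 𝐔

    𝓛 : LSet U → LSet U
    𝓛 V v = ⋀ (λ u → V u ⇒ (v ≼ u))

    𝓤 : LSet U → LSet U
    𝓤 V v = ⋀ (λ u → V u ⇒ (u ≼ v))

    IsInf : LSet U → U → Set
    IsInf V u = (𝓛 V u ≡ 𝟏) × (𝓤 (𝓛 V) u ≡ 𝟏)

    IsSup : LSet U → U → Set
    IsSup V u = (𝓤 V u ≡ 𝟏) × (𝓛 (𝓤 V) u ≡ 𝟏)

    -- completely lattice L-ordered set: every L-set has an infimum and a
    -- supremum (they are unique, so we package them as functions)
    record CompletelyLattice : Set where
      field
        inf : LSet U → U
        sup : LSet U → U
        inf-isInf : ∀ V → IsInf V (inf V)
        sup-isSup : ∀ V → IsSup V (sup V)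

    _∘ʳ_ : Rel U → LSet U → LSet U
    (R ∘ʳ B) x = ⋁ (λ y → R x y ⊗ B y)

    _ʳ∘_ : LSet U → Rel U → LSet U
    (A ʳ∘ R) y = ⋁ (λ x → A x ⊗ R x y)

    _⁺ : Rel U → LSet U → LSet U → Carrier
    (R ⁺) A B = S A (R ∘ʳ B) ∧ S B (A ʳ∘ R)

    IsCompatible : Rel U → Set
    IsCompatible R = ∀ u v u' v' → R u v ⊗ (u ≈ u') ⊗ (v ≈ v') ≤ R u' v'

    record IsComplete (CL : CompletelyLattice) (R : Rel U) : Set where
      open CompletelyLattice CL
      field
        compatible : IsCompatible R
        inf-pres : ∀ V₁ V₂ → (R ⁺) V₁ V₂ ≤ R (inf V₁) (inf V₂)
        sup-pres : ∀ V₁ V₂ → (R ⁺) V₁ V₂ ≤ R (sup V₁) (sup V₂)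

    record IsLTolerance (R : Rel U) : Set where
      field
        refl : ∀ u → R u u ≡ 𝟏
        sym  : ∀ u v → R u v ≡ R v u

    class : Rel U → U → LSet U
    class R u v = R u v

    interval : U → U → LSet U
    interval v u w = (v ≼ w) ∧ (w ≼ u)

-- Write a = inf [u] and b = sup [u].  Applying completeness of ∼ to the pair of
-- L-sets [u] and {u} (whose power-relation degree is 1) shows a ∼ u = b ∼ u = 1.
-- Every member of [u] lies above a and below b, which gives [u] ⊆ [[a, b]].
-- Conversely let α = [[a, b]](w).  Completeness applied to {w, α/b} and {w, u}
-- yields α ≤ w ∼ c for c = inf {w, u}, and applied once more to {w, α/a} and
-- {c, u} yields α ≤ w ∼ u, because w is the infimum of {w, α/b} and the
-- supremum of {w, α/a}, while u is the supremum of {c, u}.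

module Submission where

open import Data.Product using (_,_; proj₁; proj₂)
open import Relation.Binary.Bundles using (Poset)
open import Relation.Binary.PropositionalEquality using (_≡_; sym; trans; cong; cong₂)
open import Relation.Binary.Structures using (IsPartialOrder)
import Relation.Binary.Reasoning.PartialOrder as PosetReasoning

open import Defs

module ResiduatedLatticeProperties (𝐋 : CompleteResiduatedLattice) where
  open CompleteResiduatedLattice 𝐋

  open IsPartialOrder isPartialOrder public
    using () renaming (refl to ≤-refl; reflexive to ≤-reflexive; trans to ≤-trans; antisym to ≤-antisym)

  poset : Poset _ _ _
  poset = record { Carrier = Carrier ; _≈_ = _≡_ ; _≤_ = _≤_ ; isPartialOrder = isPartialOrder }

  open PosetReasoning poset public

  𝟏≤⇒≡𝟏 : ∀ {a} → 𝟏 ≤ a → a ≡ 𝟏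
  𝟏≤⇒≡𝟏 {a} 𝟏≤a = ≤-antisym (𝟏-greatest a) 𝟏≤a

  ⊗-identityʳ : ∀ a → a ⊗ 𝟏 ≡ a
  ⊗-identityʳ a = trans (⊗-comm a 𝟏) (⊗-identityˡ a)

  ⊗-≡𝟏ˡ : ∀ {a} b → a ≡ 𝟏 → a ⊗ b ≡ b
  ⊗-≡𝟏ˡ b a≡𝟏 = trans (cong (_⊗ b) a≡𝟏) (⊗-identityˡ b)

  ⊗-≡𝟏ʳ : ∀ a {b} → b ≡ 𝟏 → a ⊗ b ≡ a
  ⊗-≡𝟏ʳ a b≡𝟏 = trans (cong (a ⊗_) b≡𝟏) (⊗-identityʳ a)

  ⊗-monoˡ-≤ : ∀ c {a b} → a ≤ b → a ⊗ c ≤ b ⊗ c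
  ⊗-monoˡ-≤ _ a≤b = adjoint₂ (≤-trans a≤b (adjoint₁ ≤-refl))

  ⊗-monoʳ-≤ : ∀ c {a b} → a ≤ b → c ⊗ a ≤ c ⊗ b
  ⊗-monoʳ-≤ c {a} {b} a≤b = begin
    c ⊗ a  ≡⟨ ⊗-comm c a ⟩
    a ⊗ c  ≤⟨ ⊗-monoˡ-≤ c a≤b ⟩
    b ⊗ c  ≡⟨ ⊗-comm b c ⟩
    c ⊗ b  ∎

  x⊗y≤y : ∀ a b → a ⊗ b ≤ b
  x⊗y≤y a b = begin
    a ⊗ b  ≤⟨ ⊗-monoˡ-≤ b (𝟏-greatest a) ⟩
    𝟏 ⊗ b  ≡⟨ ⊗-identityˡ b ⟩
    b      ∎

  ⊗-∨-least : ∀ {β a b c} → β ⊗ a ≤ c → β ⊗ b ≤ c → β ⊗ (a ∨ b) ≤ c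
  ⊗-∨-least {β} {a} {b} {c} βa≤c βb≤c = begin
    β ⊗ (a ∨ b)  ≡⟨ ⊗-comm β (a ∨ b) ⟩
    (a ∨ b) ⊗ β  ≤⟨ adjoint₂ (∨-least a b (β ⇒ c) (residual βa≤c) (residual βb≤c)) ⟩
    c            ∎
    where
    residual : ∀ {x} → β ⊗ x ≤ c → x ≤ β ⇒ c
    residual {x} βx≤c = adjoint₁ (≤-trans (≤-reflexive (⊗-comm x β)) βx≤c)

  ≤-⋁ : ∀ {I : Set} (f : I → Carrier) {a} (i : I) → a ≤ f i → a ≤ ⋁ f
  ≤-⋁ f i a≤fi = ≤-trans a≤fi (⋁-upper f i)

  module _ {X : Set} {A B : LSet 𝐋 X} where

    ≤-S : ∀ {β} → (∀ x → β ⊗ A x ≤ B x) → β ≤ S 𝐋 A B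
    ≤-S βA≤B = ⋀-greatest _ _ (λ x → adjoint₁ (βA≤B x))

    S⊗A≤B : ∀ x → S 𝐋 A B ⊗ A x ≤ B x
    S⊗A≤B x = adjoint₂ (⋀-lower _ x)

    S≤B-at-𝟏 : ∀ {x} → A x ≡ 𝟏 → S 𝐋 A B ≤ B x
    S≤B-at-𝟏 {x} Ax≡𝟏 = begin
      S 𝐋 A B        ≡⟨ ⊗-≡𝟏ʳ (S 𝐋 A B) Ax≡𝟏 ⟨
      S 𝐋 A B ⊗ A x  ≤⟨ S⊗A≤B x ⟩
      B x            ∎

    S≡𝟏⇒⊆ : S 𝐋 A B ≡ 𝟏 → ∀ x → A x ≤ B x
    S≡𝟏⇒⊆ S≡𝟏 x = begin
      A x            ≡⟨ ⊗-≡𝟏ˡ (A x) S≡𝟏 ⟨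
      S 𝐋 A B ⊗ A x  ≤⟨ S⊗A≤B x ⟩
      B x            ∎

    ⊆⇒S≡𝟏 : (∀ x → A x ≤ B x) → S 𝐋 A B ≡ 𝟏
    ⊆⇒S≡𝟏 A⊆B = 𝟏≤⇒≡𝟏 (≤-S (λ x → ≤-trans (≤-reflexive (⊗-identityˡ (A x))) (A⊆B x)))

module LOrderedSetProperties (𝐋 : CompleteResiduatedLattice) (𝐔 : LOrderedSet 𝐋) where
  open CompleteResiduatedLattice 𝐋
  open ResiduatedLatticeProperties 𝐋
  open LOrderedSet 𝐔
  open IsLEquality ≈-isLEquality using (sep) renaming (refl to ≈-refl)

  module _ {R : Rel 𝐋 U} (R-compatible : IsCompatible 𝐋 𝐔 R) where

    compatibleˡ : ∀ a b a' → R a b ⊗ (a ≈ a') ≤ R a' b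
    compatibleˡ a b a' = begin
      R a b ⊗ (a ≈ a')            ≡⟨ ⊗-≡𝟏ʳ (R a b ⊗ (a ≈ a')) (≈-refl b) ⟨
      R a b ⊗ (a ≈ a') ⊗ (b ≈ b)  ≤⟨ R-compatible a b a' b ⟩
      R a' b                      ∎

    compatibleʳ : ∀ a b b' → R a b ⊗ (b ≈ b') ≤ R a b'
    compatibleʳ a b b' = begin
      R a b ⊗ (b ≈ b')            ≡⟨ cong (_⊗ (b ≈ b')) (⊗-≡𝟏ʳ (R a b) (≈-refl a)) ⟨
      R a b ⊗ (a ≈ a) ⊗ (b ≈ b')  ≤⟨ R-compatible a b a b' ⟩
      R a b'                      ∎

    module _ {a} (Raa≡𝟏 : R a a ≡ 𝟏) where

      ≈⊆R : ∀ b → a ≈ b ≤ R a b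
      ≈⊆R b = ≤-trans (≤-reflexive (sym (⊗-≡𝟏ˡ (a ≈ b) Raa≡𝟏))) (compatibleʳ a a b)

      ≈⊆R˘ : ∀ b → a ≈ b ≤ R b a
      ≈⊆R˘ b = ≤-trans (≤-reflexive (sym (⊗-≡𝟏ˡ (a ≈ b) Raa≡𝟏))) (compatibleˡ a a b)

  ≼-antisym-𝟏 : ∀ {x y} → (x ≼ y) ≡ 𝟏 → (y ≼ x) ≡ 𝟏 → x ≡ y
  ≼-antisym-𝟏 {x} {y} x≼y y≼x = sep x y (𝟏≤⇒≡𝟏 (begin
    𝟏                  ≤⟨ ∧-greatest _ _ 𝟏 (≤-reflexive (sym x≼y)) (≤-reflexive (sym y≼x)) ⟩
    (x ≼ y) ∧ (y ≼ x)  ≤⟨ ≼-antisym x y ⟩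
    x ≈ y              ∎))

  minimum⇒isInf : ∀ {V x} → V x ≡ 𝟏 → (∀ v → V v ≤ (x ≼ v)) → IsInf 𝐋 𝐔 V x
  minimum⇒isInf Vx≡𝟏 lower = ⊆⇒S≡𝟏 lower , ⊆⇒S≡𝟏 (λ _ → S≤B-at-𝟏 Vx≡𝟏)

  maximum⇒isSup : ∀ {V x} → V x ≡ 𝟏 → (∀ v → V v ≤ (v ≼ x)) → IsSup 𝐋 𝐔 V x
  maximum⇒isSup Vx≡𝟏 upper = ⊆⇒S≡𝟏 upper , ⊆⇒S≡𝟏 (λ _ → S≤B-at-𝟏 Vx≡𝟏)

  class≈-isInf : ∀ u → IsInf 𝐋 𝐔 (class 𝐋 𝐔 _≈_ u) u
  class≈-isInf u = minimum⇒isInf (≈-refl u) (≈⊆R ≼-compat (≼-refl u))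

  class≈-isSup : ∀ u → IsSup 𝐋 𝐔 (class 𝐋 𝐔 _≈_ u) u
  class≈-isSup u = maximum⇒isSup (≈-refl u) (≈⊆R˘ ≼-compat (≼-refl u))

  -- The ≈-closure of the L-set {1/x, p/y}.
  doubleton : Carrier → U → U → LSet 𝐋 U
  doubleton p x y v = (x ≈ v) ∨ (p ⊗ (y ≈ v))

  doubleton-first : ∀ p x y → doubleton p x y x ≡ 𝟏
  doubleton-first p x y = 𝟏≤⇒≡𝟏 (≤-trans (≤-reflexive (sym (≈-refl x))) (∨-upperˡ _ _))

  doubleton-second : ∀ p x y → p ≤ doubleton p x y y
  doubleton-second p x y = ≤-trans (≤-reflexive (sym (⊗-≡𝟏ʳ p (≈-refl y)))) (∨-upperʳ _ _)

  doubleton-isInf : ∀ {p x y} → p ≤ (x ≼ y) → IsInf 𝐋 𝐔 (doubleton p x y) x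
  doubleton-isInf {p} {x} {y} p≤x≼y = minimum⇒isInf (doubleton-first p x y) λ v →
    ∨-least _ _ _ (≈⊆R ≼-compat (≼-refl x) v)
                  (≤-trans (⊗-monoˡ-≤ (y ≈ v) p≤x≼y) (compatibleʳ ≼-compat x y v))

  doubleton-isSup : ∀ {p x y} → p ≤ (y ≼ x) → IsSup 𝐋 𝐔 (doubleton p x y) x
  doubleton-isSup {p} {x} {y} p≤y≼x = maximum⇒isSup (doubleton-first p x y) λ v →
    ∨-least _ _ _ (≈⊆R˘ ≼-compat (≼-refl x) v)
                  (≤-trans (⊗-monoˡ-≤ (y ≈ v) p≤y≼x) (compatibleˡ ≼-compat y x v))

  doubleton-isSup₂ : ∀ {x y} → (x ≼ y) ≡ 𝟏 → IsSup 𝐋 𝐔 (doubleton 𝟏 x y) y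
  doubleton-isSup₂ {x} {y} x≼y = maximum⇒isSup (𝟏≤⇒≡𝟏 (doubleton-second 𝟏 x y)) λ v →
    ∨-least _ _ _ (≤-trans (≤-reflexive (sym (⊗-≡𝟏ˡ (x ≈ v) x≼y))) (compatibleˡ ≼-compat x y v))
                  (≤-trans (x⊗y≤y 𝟏 (y ≈ v)) (≈⊆R˘ ≼-compat (≼-refl y) v))

  module _ {R : Rel 𝐋 U} (R-compatible : IsCompatible 𝐋 𝐔 R) where

    doubleton-⁺ : ∀ {β p x₁ y₁ x₂ y₂} → β ≤ R x₁ x₂ → R y₁ y₂ ≡ 𝟏 → β ≤ p
                → β ≤ _⁺ 𝐋 𝐔 R (doubleton p x₁ y₁) (doubleton 𝟏 x₂ y₂)
    doubleton-⁺ {β} {p} {x₁} {y₁} {x₂} {y₂} β≤Rx₁x₂ Ry₁y₂≡𝟏 β≤p =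
      ∧-greatest _ _ _ (≤-S forth) (≤-S back)
      where
      forth : ∀ x → β ⊗ doubleton p x₁ y₁ x ≤ ⋁ (λ y → R x y ⊗ doubleton 𝟏 x₂ y₂ y)
      forth x = ⊗-∨-least
        (≤-⋁ _ x₂ (begin
          β ⊗ (x₁ ≈ x)                  ≤⟨ ⊗-monoˡ-≤ (x₁ ≈ x) β≤Rx₁x₂ ⟩
          R x₁ x₂ ⊗ (x₁ ≈ x)            ≤⟨ compatibleˡ R-compatible x₁ x₂ x ⟩
          R x x₂                        ≡⟨ ⊗-≡𝟏ʳ (R x x₂) (doubleton-first 𝟏 x₂ y₂) ⟨
          R x x₂ ⊗ doubleton 𝟏 x₂ y₂ x₂  ∎))
        (≤-⋁ _ y₂ (begin
          β ⊗ (p ⊗ (y₁ ≈ x))            ≤⟨ ≤-trans (x⊗y≤y β _) (x⊗y≤y p _) ⟩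
          y₁ ≈ x                        ≡⟨ ⊗-≡𝟏ˡ (y₁ ≈ x) Ry₁y₂≡𝟏 ⟨
          R y₁ y₂ ⊗ (y₁ ≈ x)            ≤⟨ compatibleˡ R-compatible y₁ y₂ x ⟩
          R x y₂                        ≡⟨ ⊗-identityʳ (R x y₂) ⟨
          R x y₂ ⊗ 𝟏                    ≤⟨ ⊗-monoʳ-≤ (R x y₂) (doubleton-second 𝟏 x₂ y₂) ⟩
          R x y₂ ⊗ doubleton 𝟏 x₂ y₂ y₂  ∎))
      back : ∀ y → β ⊗ doubleton 𝟏 x₂ y₂ y ≤ ⋁ (λ x → doubleton p x₁ y₁ x ⊗ R x y)
      back y = ⊗-∨-least
        (≤-⋁ _ x₁ (begin
          β ⊗ (x₂ ≈ y)                  ≤⟨ ⊗-monoˡ-≤ (x₂ ≈ y) β≤Rx₁x₂ ⟩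
          R x₁ x₂ ⊗ (x₂ ≈ y)            ≤⟨ compatibleʳ R-compatible x₁ x₂ y ⟩
          R x₁ y                        ≡⟨ ⊗-≡𝟏ˡ (R x₁ y) (doubleton-first p x₁ y₁) ⟨
          doubleton p x₁ y₁ x₁ ⊗ R x₁ y  ∎))
        (≤-⋁ _ y₁ (begin
          β ⊗ (𝟏 ⊗ (y₂ ≈ y))            ≤⟨ ⊗-monoˡ-≤ _ β≤p ⟩
          p ⊗ (𝟏 ⊗ (y₂ ≈ y))            ≤⟨ ⊗-monoʳ-≤ p (x⊗y≤y 𝟏 (y₂ ≈ y)) ⟩
          p ⊗ (y₂ ≈ y)                  ≡⟨ cong (p ⊗_) (⊗-≡𝟏ˡ (y₂ ≈ y) Ry₁y₂≡𝟏) ⟨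
          p ⊗ (R y₁ y₂ ⊗ (y₂ ≈ y))      ≤⟨ ⊗-monoʳ-≤ p (compatibleʳ R-compatible y₁ y₂ y) ⟩
          p ⊗ R y₁ y                    ≤⟨ ⊗-monoˡ-≤ (R y₁ y) (doubleton-second p x₁ y₁) ⟩
          doubleton p x₁ y₁ y₁ ⊗ R y₁ y  ∎))

  module _ {R : Rel 𝐋 U} (R-tolerance : IsLTolerance 𝐋 𝐔 R) (R-compatible : IsCompatible 𝐋 𝐔 R) where
    open IsLTolerance R-tolerance renaming (refl to R-refl; sym to R-sym)

    class-⁺-class≈ : ∀ u → 𝟏 ≤ _⁺ 𝐋 𝐔 R (class 𝐋 𝐔 R u) (class 𝐋 𝐔 _≈_ u)
    class-⁺-class≈ u = ∧-greatest _ _ _ (≤-S forth) (≤-S back)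
      where
      forth : ∀ x → 𝟏 ⊗ R u x ≤ ⋁ (λ y → R x y ⊗ (u ≈ y))
      forth x = ≤-⋁ _ u (≤-reflexive (begin-equality
        𝟏 ⊗ R u x      ≡⟨ ⊗-identityˡ (R u x) ⟩
        R u x          ≡⟨ R-sym u x ⟩
        R x u          ≡⟨ ⊗-≡𝟏ʳ (R x u) (≈-refl u) ⟨
        R x u ⊗ (u ≈ u) ∎))
      back : ∀ y → 𝟏 ⊗ (u ≈ y) ≤ ⋁ (λ x → R u x ⊗ R x y)
      back y = ≤-⋁ _ u (begin
        𝟏 ⊗ (u ≈ y)    ≡⟨ ⊗-identityˡ (u ≈ y) ⟩
        u ≈ y          ≤⟨ ≈⊆R R-compatible (R-refl u) y ⟩
        R u y          ≡⟨ ⊗-≡𝟏ˡ (R u y) (R-refl u) ⟨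
        R u u ⊗ R u y  ∎)

module CompletelyLatticeProperties (𝐋 : CompleteResiduatedLattice) (𝐔 : LOrderedSet 𝐋)
                                   (CL : CompletelyLattice 𝐋 𝐔) where
  open CompleteResiduatedLattice 𝐋
  open ResiduatedLatticeProperties 𝐋
  open LOrderedSet 𝐔
  open LOrderedSetProperties 𝐋 𝐔
  open CompletelyLattice CL

  inf-unique : ∀ {V x} → IsInf 𝐋 𝐔 V x → inf V ≡ x
  inf-unique {V} {x} (x-lower , x-greatest) = ≼-antisym-𝟏
    (𝟏≤⇒≡𝟏 (≤-trans (≤-reflexive (sym (proj₁ (inf-isInf V)))) (S≡𝟏⇒⊆ x-greatest (inf V))))
    (𝟏≤⇒≡𝟏 (≤-trans (≤-reflexive (sym x-lower)) (S≡𝟏⇒⊆ (proj₂ (inf-isInf V)) x)))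

  sup-unique : ∀ {V x} → IsSup 𝐋 𝐔 V x → sup V ≡ x
  sup-unique {V} {x} (x-upper , x-least) = ≼-antisym-𝟏
    (𝟏≤⇒≡𝟏 (≤-trans (≤-reflexive (sym x-upper)) (S≡𝟏⇒⊆ (proj₂ (sup-isSup V)) x)))
    (𝟏≤⇒≡𝟏 (≤-trans (≤-reflexive (sym (proj₁ (sup-isSup V)))) (S≡𝟏⇒⊆ x-least (sup V))))

  inf-lower : ∀ V v → V v ≤ (inf V ≼ v)
  inf-lower V = S≡𝟏⇒⊆ (proj₁ (inf-isInf V))

  sup-upper : ∀ V v → V v ≤ (v ≼ sup V)
  sup-upper V = S≡𝟏⇒⊆ (proj₁ (sup-isSup V))

module CompleteToleranceProperties (𝐋 : CompleteResiduatedLattice) (𝐔 : LOrderedSet 𝐋)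
    (CL : CompletelyLattice 𝐋 𝐔) {_∼_ : Rel 𝐋 (LOrderedSet.U 𝐔)}
    (∼-tolerance : IsLTolerance 𝐋 𝐔 _∼_) (∼-complete : IsComplete 𝐋 𝐔 CL _∼_) where
  open CompleteResiduatedLattice 𝐋
  open ResiduatedLatticeProperties 𝐋
  open LOrderedSet 𝐔
  open LOrderedSetProperties 𝐋 𝐔
  open CompletelyLattice CL
  open CompletelyLatticeProperties 𝐋 𝐔 CL
  open IsComplete ∼-complete
  open IsLTolerance ∼-tolerance renaming (refl to ∼-refl; sym to ∼-sym)

  [_] : U → LSet 𝐋 U
  [ u ] = class 𝐋 𝐔 _∼_ u

  inf-class∼ : ∀ u → (inf [ u ] ∼ u) ≡ 𝟏
  inf-class∼ u = 𝟏≤⇒≡𝟏 (begin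
    𝟏                                   ≤⟨ class-⁺-class≈ ∼-tolerance compatible u ⟩
    _⁺ 𝐋 𝐔 _∼_ [ u ] (class 𝐋 𝐔 _≈_ u)  ≤⟨ inf-pres _ _ ⟩
    inf [ u ] ∼ inf (class 𝐋 𝐔 _≈_ u)   ≡⟨ cong (inf [ u ] ∼_) (inf-unique (class≈-isInf u)) ⟩
    inf [ u ] ∼ u                       ∎)

  sup-class∼ : ∀ u → (sup [ u ] ∼ u) ≡ 𝟏
  sup-class∼ u = 𝟏≤⇒≡𝟏 (begin
    𝟏                                   ≤⟨ class-⁺-class≈ ∼-tolerance compatible u ⟩
    _⁺ 𝐋 𝐔 _∼_ [ u ] (class 𝐋 𝐔 _≈_ u)  ≤⟨ sup-pres _ _ ⟩
    sup [ u ] ∼ sup (class 𝐋 𝐔 _≈_ u)   ≡⟨ cong (sup [ u ] ∼_) (sup-unique (class≈-isSup u)) ⟩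
    sup [ u ] ∼ u                       ∎)

  class⊆interval : ∀ u w → [ u ] w ≤ interval 𝐋 𝐔 (inf [ u ]) (sup [ u ]) w
  class⊆interval u w = ∧-greatest _ _ _ (inf-lower [ u ] w) (sup-upper [ u ] w)

  interval⊆class : ∀ u w → interval 𝐋 𝐔 (inf [ u ]) (sup [ u ]) w ≤ [ u ] w
  interval⊆class u w = begin
    α                                             ≤⟨ doubleton-⁺ compatible α≤w∼c (inf-class∼ u) ≤-refl ⟩
    _⁺ 𝐋 𝐔 _∼_ (doubleton α w a) (doubleton 𝟏 c u) ≤⟨ sup-pres _ _ ⟩
    sup (doubleton α w a) ∼ sup (doubleton 𝟏 c u)  ≡⟨ cong₂ _∼_ (sup-unique (doubleton-isSup (∧-lowerˡ _ _)))
                                                               (sup-unique (doubleton-isSup₂ c≼u)) ⟩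
    w ∼ u                                         ≡⟨ ∼-sym w u ⟩
    u ∼ w                                         ∎
    where
    a = inf [ u ]
    b = sup [ u ]
    α = interval 𝐋 𝐔 a b w
    c = inf (doubleton 𝟏 w u)

    c≼u : (c ≼ u) ≡ 𝟏
    c≼u = 𝟏≤⇒≡𝟏 (≤-trans (doubleton-second 𝟏 w u) (inf-lower (doubleton 𝟏 w u) u))

    α≤w∼c : α ≤ w ∼ c
    α≤w∼c = begin
      α                                             ≤⟨ doubleton-⁺ compatible α≤w∼w (sup-class∼ u) ≤-refl ⟩
      _⁺ 𝐋 𝐔 _∼_ (doubleton α w b) (doubleton 𝟏 w u) ≤⟨ inf-pres _ _ ⟩
      inf (doubleton α w b) ∼ c                     ≡⟨ cong (_∼ c) (inf-unique (doubleton-isInf (∧-lowerʳ _ _))) ⟩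
      w ∼ c                                         ∎
      where
      α≤w∼w : α ≤ w ∼ w
      α≤w∼w = ≤-trans (𝟏-greatest α) (≤-reflexive (sym (∼-refl w)))

theorem13 : (𝐋 : CompleteResiduatedLattice) (𝐔 : LOrderedSet 𝐋)
    (CL : CompletelyLattice 𝐋 𝐔) (_∼_ : Rel 𝐋 (LOrderedSet.U 𝐔))
    → IsLTolerance 𝐋 𝐔 _∼_ → IsComplete 𝐋 𝐔 CL _∼_
    → (u : LOrderedSet.U 𝐔)
    → (w : LOrderedSet.U 𝐔)
    → class 𝐋 𝐔 _∼_ u w
      ≡ interval 𝐋 𝐔 (CompletelyLattice.inf CL (class 𝐋 𝐔 _∼_ u))
                     (CompletelyLattice.sup CL (class 𝐋 𝐔 _∼_ u)) w
theorem13 𝐋 𝐔 CL _∼_ ∼-tolerance ∼-complete u w =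
  ≤-antisym (class⊆interval u w) (interval⊆class u w)
  where
  open ResiduatedLatticeProperties 𝐋
  open CompleteToleranceProperties 𝐋 𝐔 CL ∼-tolerance ∼-complete
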